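{- Let $n\ge 1$, $\ell\ge 3$ and $1\le k\le\ell$. Then for every formula $\psi(x_1,\ldots,x_k)\in\mathsf{C}^{\mathrm{w}}_\ell$ there is a formula $\hat\psi(x_1,\ldots,x_k)\in\mathsf{C}^{\mathrm{w}}_\ell$ such that for every graph $G$ of order $|G|\le n$, every connected component $A$ of $G$ and all $u_1,\ldots,u_k\in V(A)$ we have $G\models\hat\psi(u_1,\ldots,u_k)$ if and only if $A\models\psi(u_1,\ldots,u_k)$.
   Context: Graphs are finite, simple, undirected, possibly arc-coloured (a colour relation $R_c$ for each colour, plus the edge relation $E$). $\mathsf{C}$ is first-order logic with counting quantifiers $\exists^{\ge p}x$ ($p\ge1$); atomic formulae $x=y$, $E(x,y)$, $R_c(x,y)$; connectives $\neg,\vee$. A formula has width $k$ if each subformula has at most $k$ free variables; $\mathsf{C}^{\mathrm{w}}_k$ denotes the $\mathsf{C}$-formulae of width at most $k$. Writing $\psi(x_1,\dots,x_k)$ means that the free variables of $\psi$ are among $x_1,\dots,x_k$ (not all need occur). -}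

module Defs where

open import Data.Nat using (ℕ; zero; suc; _≤_; _<_; _<?_; _≟_; _≡ᵇ_)
open import Data.Fin using (Fin; fromℕ<)
open import Data.Bool using (Bool; true; false; if_then_else_)
open import Data.List using (List; []; _∷_; _++_; length; filter; deduplicate)
open import Data.List.Relation.Unary.All using (All)
open import Data.List.Relation.Unary.Unique.Propositional using (Unique)
open import Data.Product using (Σ; _×_)
open import Data.Sum using (_⊎_)
open import Data.Unit using (⊤)
open import Relation.Nullary using (¬_; ¬?; yes; no)
open import Relation.Binary.PropositionalEquality using (_≡_)

record Graph (m : ℕ) : Set where
  field
    order  : ℕ
    E      : Fin order → Fin order → Bool
    E-irr  : ∀ v → E v v ≡ false
    E-sym  : ∀ u v → E u v ≡ E v u
    R      : Fin m → Fin order → Fin order → Bool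

open Graph public

Vertex : ∀ {m} → Graph m → Set
Vertex G = Fin (order G)

data Reach {m} (G : Graph m) (a : Vertex G) : Vertex G → Set where
  here : Reach G a a
  step : ∀ {v w} → Reach G a v → E G v w ≡ true → Reach G a w

-- Syntax of C over the vocabulary {E, R_0, ..., R_(m-1)}.
-- Variables are natural numbers; variable i stands for x_(i+1).

Var : Set
Var = ℕ

data Formula (m : ℕ) : Set where
  eq   : Var → Var → Formula m
  edge : Var → Var → Formula m
  col  : Fin m → Var → Var → Formula m
  neg  : Formula m → Formula m
  or   : Formula m → Formula m → Formula m
  ex≥  : (p : ℕ) → 1 ≤ p → Var → Formula m → Formula m

-- free variables (possibly with repetitions)
fv : ∀ {m} → Formula m → List Var
fv (eq x y)       = x ∷ y ∷ []
fv (edge x y)     = x ∷ y ∷ []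
fv (col c x y)    = x ∷ y ∷ []
fv (neg φ)        = fv φ
fv (or φ ψ)       = fv φ ++ fv ψ
fv (ex≥ p _ x φ)  = filter (λ y → ¬? (y ≟ x)) (fv φ)

nfv : ∀ {m} → Formula m → ℕ
nfv φ = length (deduplicate _≟_ (fv φ))

Width : ∀ {m} → ℕ → Formula m → Set
Width ℓ φ@(eq _ _)      = nfv φ ≤ ℓ
Width ℓ φ@(edge _ _)    = nfv φ ≤ ℓ
Width ℓ φ@(col _ _ _)   = nfv φ ≤ ℓ
Width ℓ φ@(neg ψ)       = nfv φ ≤ ℓ × Width ℓ ψ
Width ℓ φ@(or ψ χ)      = nfv φ ≤ ℓ × Width ℓ ψ × Width ℓ χ
Width ℓ φ@(ex≥ _ _ _ ψ) = nfv φ ≤ ℓ × Width ℓ ψ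

-- free variables among x_1, ..., x_k (i.e. variable indices < k)
FreeAmong : ∀ {m} → ℕ → Formula m → Set
FreeAmong k φ = All (λ y → y < k) (fv φ)

-- Sat G D ρ φ : the structure induced by G on the vertex set
-- D satisfies φ under assignment ρ (quantifiers range over D; atomic
-- relations are those of G restricted to D).  D = everything gives G ⊨ φ,
-- D = a connected component gives A ⊨ φ for the induced subgraph A.

update : ∀ {A : Set} → (Var → A) → Var → A → Var → A
update ρ x v y = if y ≡ᵇ x then v else ρ y

Sat : ∀ {m} (G : Graph m) → (Vertex G → Set) → (Var → Vertex G) → Formula m → Set
Sat G D ρ (eq x y)      = ρ x ≡ ρ y
Sat G D ρ (edge x y)    = E G (ρ x) (ρ y) ≡ true
Sat G D ρ (col c x y)   = R G c (ρ x) (ρ y) ≡ true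
Sat G D ρ (neg φ)       = ¬ Sat G D ρ φ
Sat G D ρ (or φ ψ)      = Sat G D ρ φ ⊎ Sat G D ρ ψ
Sat G D ρ (ex≥ p _ x φ) =
  Σ (List (Vertex G)) λ vs →
    Unique vs × p ≤ length vs × All (λ v → D v × Sat G D (update ρ x v) φ) vs

assign : ∀ {V : Set} {k : ℕ} → V → (Fin k → V) → Var → V
assign {k = k} d u i with i <? k
... | yes i<k = u (fromℕ< i<k)
... | no _    = d

Whole : ∀ {m} (G : Graph m) → Vertex G → Set
Whole G _ = ⊤

Component : ∀ {m} (G : Graph m) → Vertex G → Vertex G → Set
Component G a v = Reach G a v

module Submission where

-- In such a graph, v lies in the component of r iff there is a walk of length
-- at most n from r to v, and "there is a walk of length ≤ j from a to b" is
-- expressible with three variables (Within).  Since every variable is assigned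
-- a vertex of the component, a quantifier ∃^{≥p} x φ is relativised by guarding
-- x with reachability from an "anchor" variable s ≠ x.  To stay within width ℓ
-- the anchor is a free variable of ∃^{≥p} x φ whenever there is one (and a
-- vacuous quantification over x is split off from φ); for a sentence any
-- anchor will do, and an anchor clashing with x is renamed.
--
-- The theorem is the translation anchored at x_1 (variable 0).

open import Defs
open import Data.Nat using (ℕ; zero; suc; _+_; _≤_; _<_; z≤n; s≤s; _≟_; _≤?_; _<?_; _≡ᵇ_)
open import Data.Nat.Properties using (module ≤-Reasoning; +-suc; ≤-trans; ≤-reflexive; n≤1+n; n<1+n; m≤m+n; m≤n+m; <⇒≢; ≡ᵇ⇒≡; ≡⇒≡ᵇ)
open import Data.Fin using (Fin) renaming (_≟_ to _≟ᶠ_)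
open import Data.Bool using (true; false) renaming (_≟_ to _≟ᵇ_)
open import Data.List using (List; []; _∷_; _++_; length; filter; deduplicate; [_]; allFin; upTo)
open import Data.List.Properties using (length-++; length-tabulate; length-upTo)
open import Data.List.Membership.Propositional using (_∈_; _∉_)
open import Data.List.Membership.Propositional.Properties
  using (∈-++⁺ˡ; ∈-++⁺ʳ; ∈-++⁻; ∈-∃++; ∈-filter⁺; ∈-filter⁻; ∈-allFin; ∈-deduplicate⁻; ∈-deduplicate⁺; ∈-upTo⁺)
open import Data.List.Relation.Binary.Subset.Propositional using (_⊆_)
open import Data.List.Relation.Binary.Subset.Propositional.Properties using (⊆-refl; ∈-∷⁺ʳ; ∷⁺ʳ; xs⊆x∷xs; xs⊆xs++ys; xs⊆ys++xs)
open import Data.List.Relation.Unary.Any using (here; there; any?)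
open import Data.List.Relation.Unary.All as All using (All; []; _∷_)
open import Data.List.Relation.Unary.All.Properties using (all-filter; ¬Any⇒All¬)
open import Data.List.Relation.Unary.AllPairs using ([]; _∷_)
open import Data.List.Relation.Unary.Unique.Propositional using (Unique)
import Data.List.Relation.Unary.Unique.Propositional.Properties as Unique
open import Data.List.Relation.Unary.Unique.DecPropositional.Properties _≟_ using (deduplicate-!)
open import Data.Product using (Σ; _×_; _,_; proj₁; proj₂)
open import Data.Product.Function.NonDependent.Propositional using (_×-⇔_)
open import Data.Sum using (_⊎_; inj₁; inj₂)
open import Data.Sum.Function.Propositional using (_⊎-⇔_)
open import Data.Unit using (⊤; tt)
open import Data.Empty using (⊥-elim)
open import Function using (id)
open import Function.Bundles using (_⇔_; mk⇔; Equivalence)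
open import Function.Construct.Identity using (⇔-id)
open import Function.Construct.Composition using (_⇔-∘_)
open import Relation.Nullary using (¬_; ¬?; yes; no; Dec)
open import Relation.Nullary.Decidable using (_⊎-dec_; map′)
open import Relation.Binary.PropositionalEquality using (_≡_; _≢_; refl; sym; trans; cong; subst; subst₂)

open Equivalence using (to; from)

unique-length : ∀ {A : Set} {xs ys : List A} → Unique xs → xs ⊆ ys → length xs ≤ length ys
unique-length {xs = []} _ _ = z≤n
unique-length {xs = x ∷ xs} {ys} (x∉xs ∷ uxs) xs⊆ys with ∈-∃++ (xs⊆ys (here refl))
... | ys₁ , ys₂ , refl = begin
  suc (length xs)                ≤⟨ s≤s (unique-length uxs rest⊆) ⟩
  suc (length (ys₁ ++ ys₂))      ≡⟨ cong suc (length-++ ys₁) ⟩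
  suc (length ys₁ + length ys₂)  ≡⟨ sym (+-suc (length ys₁) (length ys₂)) ⟩
  length ys₁ + length (x ∷ ys₂)  ≡⟨ sym (length-++ ys₁) ⟩
  length (ys₁ ++ x ∷ ys₂)        ∎
  where
  open ≤-Reasoning
  -- the elements of xs other than x avoid that occurrence of x in ys
  rest⊆ : xs ⊆ ys₁ ++ ys₂
  rest⊆ z∈xs with ∈-++⁻ ys₁ (xs⊆ys (there z∈xs))
  ... | inj₁ z∈ys₁         = ∈-++⁺ˡ z∈ys₁
  ... | inj₂ (here refl)   = ⊥-elim (All.lookup x∉xs z∈xs refl)
  ... | inj₂ (there z∈ys₂) = ∈-++⁺ʳ ys₁ z∈ys₂

++-⊆ : ∀ {A : Set} {xs ys zs : List A} → xs ⊆ zs → ys ⊆ zs → xs ++ ys ⊆ zs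
++-⊆ {xs = xs} xs⊆ ys⊆ z∈ with ∈-++⁻ xs z∈
... | inj₁ z∈xs = xs⊆ z∈xs
... | inj₂ z∈ys = ys⊆ z∈ys

nvars : List Var → ℕ
nvars xs = length (deduplicate _≟_ xs)

nvars-≤ : ∀ {xs ys} → xs ⊆ ys → nvars xs ≤ length ys
nvars-≤ {xs} xs⊆ys = unique-length (deduplicate-! xs) (λ z∈ → xs⊆ys (∈-deduplicate⁻ _≟_ xs z∈))

nvars-mono : ∀ {xs ys} → xs ⊆ ys → nvars xs ≤ nvars ys
nvars-mono xs⊆ys = nvars-≤ (λ z∈ → ∈-deduplicate⁺ _≟_ (xs⊆ys z∈))

-- Walks and reachability

module Walks {m} (G : Graph m) where

  reach-trans : ∀ {a b c} → Reach G a b → Reach G b c → Reach G a c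
  reach-trans ab here         = ab
  reach-trans ab (step bc e)  = step (reach-trans ab bc) e

  reach-sym : ∀ {a b} → Reach G a b → Reach G b a
  reach-sym here = here
  reach-sym (step {v} {w} av e) = reach-trans (step here (trans (E-sym G w v) e)) (reach-sym av)

  reach-from-component : ∀ {a b c} → Reach G a b → Reach G b c ⇔ Reach G a c
  reach-from-component ab = mk⇔ (reach-trans ab) (reach-trans (reach-sym ab))

  WalkLe : ℕ → Vertex G → Vertex G → Set
  WalkLe zero    s t = s ≡ t
  WalkLe (suc j) s t = WalkLe j s t ⊎ Σ (Vertex G) λ v → WalkLe j s v × E G v t ≡ true

  walk→reach : ∀ j {s t} → WalkLe j s t → Reach G s t
  walk→reach zero    refl                = here
  walk→reach (suc j) (inj₁ w)            = walk→reach j w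
  walk→reach (suc j) (inj₂ (_ , w , e))  = step (walk→reach j w) e

  walk-refl : ∀ j {s} → WalkLe j s s
  walk-refl zero    = refl
  walk-refl (suc j) = inj₁ (walk-refl j)

  -- Path s t vs: a walk from s to t whose visited vertices are vs, latest first.
  data Path (s : Vertex G) : Vertex G → List (Vertex G) → Set where
    start  : Path s s [ s ]
    extend : ∀ {v w vs} → Path s v vs → E G v w ≡ true → Path s w (w ∷ vs)

  cut : ∀ {s v w vs} → Path s v vs → Unique vs → w ∈ vs →
        Σ (List (Vertex G)) λ ws → Path s w ws × Unique ws
  cut start        u       (here refl) = _ , start , u
  cut start        _       (there ())
  cut (extend p e) u       (here refl) = _ , extend p e , u
  cut (extend p e) (_ ∷ u) (there w∈)  = cut p u w∈

  reach→path : ∀ {s t} → Reach G s t → Σ (List (Vertex G)) λ vs → Path s t vs × Unique vs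
  reach→path here = _ , start , [] ∷ []
  reach→path (step {w = w} r e) with reach→path r
  ... | vs , p , u with any? (w ≟ᶠ_) vs
  ...   | yes w∈ = cut p u w∈
  ...   | no  w∉ = w ∷ vs , extend p e , ¬Any⇒All¬ vs w∉ ∷ u

  path→walk : ∀ {s t v vs j} → Path s t (v ∷ vs) → length vs ≤ j → WalkLe j s t
  path→walk start _ = walk-refl _
  path→walk (extend {vs = []} () _) _
  path→walk (extend {vs = _ ∷ _} p e) (s≤s le) = inj₂ (_ , path→walk p le , e)

  reach→walk : ∀ {n s t} → order G ≤ n → Reach G s t → WalkLe n s t
  reach→walk {n} ord r with reach→path r
  ... | [] , () , _
  ... | v ∷ vs , p , u = path→walk p (≤-trans (n≤1+n _) (≤-trans visited≤order ord))
    where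
    visited≤order : length (v ∷ vs) ≤ order G
    visited≤order = subst (length (v ∷ vs) ≤_) (length-tabulate id)
                      (unique-length u (λ {z} _ → ∈-allFin z))

fv-ex⁻ : ∀ {m p q x z} {φ : Formula m} → z ∈ fv (ex≥ p q x φ) → z ∈ fv φ × z ≢ x
fv-ex⁻ {x = x} = ∈-filter⁻ (λ y → ¬? (y ≟ x))

fv-ex⁺ : ∀ {m p q x z} {φ : Formula m} → z ∈ fv φ → z ≢ x → z ∈ fv (ex≥ p q x φ)
fv-ex⁺ {x = x} = ∈-filter⁺ (λ y → ¬? (y ≟ x))

update-same : ∀ {A : Set} (ρ : Var → A) x v → update ρ x v x ≡ v
update-same ρ x v with x ≡ᵇ x | ≡⇒≡ᵇ x x refl
... | true  | _  = refl
... | false | ()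

update-other : ∀ {A : Set} (ρ : Var → A) x v {y} → y ≢ x → update ρ x v y ≡ ρ y
update-other ρ x v {y} y≢x with y ≡ᵇ x | ≡ᵇ⇒≡ y x
... | true  | y≡x = ⊥-elim (y≢x (y≡x tt))
... | false | _   = refl

update-preserves : ∀ {A : Set} (P : A → Set) {ρ : Var → A} x {v} → (∀ y → P (ρ y)) → P v →
                   ∀ y → P (update ρ x v y)
update-preserves P x Pρ Pv y with y ≡ᵇ x
... | true  = Pv
... | false = Pρ y

assign-preserves : ∀ {V : Set} {k} (P : V → Set) {d : V} {u : Fin k → V} → P d → (∀ i → P (u i)) →
                   ∀ y → P (assign d u y)
assign-preserves {k = k} P Pd Pu y with y <? k
... | yes _ = Pu _
... | no  _ = Pd

conj : ∀ {m} → Formula m → Formula m → Formula m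
conj φ χ = neg (or (neg φ) (neg χ))

-- The encoding is faithful for decidable propositions.
de-morgan : ∀ {A B : Set} → Dec A → Dec B → (¬ (¬ A ⊎ ¬ B)) ⇔ (A × B)
de-morgan {A} {B} a? b? = mk⇔ (split a? b?) λ (a , b) → λ { (inj₁ ¬a) → ¬a a ; (inj₂ ¬b) → ¬b b }
  where
  split : Dec A → Dec B → ¬ (¬ A ⊎ ¬ B) → A × B
  split (yes a) (yes b) _ = a , b
  split (no ¬a) _       h = ⊥-elim (h (inj₁ ¬a))
  split _       (no ¬b) h = ⊥-elim (h (inj₂ ¬b))

module Semantics {m} (G : Graph m) where

  sat? : ∀ φ ρ → Dec (Sat G (Whole G) ρ φ)
  sat? (eq x y)    ρ = ρ x ≟ᶠ ρ y
  sat? (edge x y)  ρ = E G (ρ x) (ρ y) ≟ᵇ true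
  sat? (col c x y) ρ = R G c (ρ x) (ρ y) ≟ᵇ true
  sat? (neg φ)     ρ = ¬? (sat? φ ρ)
  sat? (or φ χ)    ρ = sat? φ ρ ⊎-dec sat? χ ρ
  sat? (ex≥ p q x φ) ρ = map′ enough bounded (p ≤? length witnesses)
    where
    holds? : ∀ v → Dec (Sat G (Whole G) (update ρ x v) φ)
    holds? v = sat? φ (update ρ x v)
    witnesses : List (Vertex G)
    witnesses = filter holds? (allFin (order G))
    enough : p ≤ length witnesses → Sat G (Whole G) ρ (ex≥ p q x φ)
    enough p≤ = witnesses , Unique.filter⁺ holds? (Unique.allFin⁺ _) , p≤ ,
                All.map (tt ,_) (all-filter holds? (allFin (order G)))
    bounded : Sat G (Whole G) ρ (ex≥ p q x φ) → p ≤ length witnesses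
    bounded (vs , u , p≤ , sats) = ≤-trans p≤ (unique-length u λ v∈ →
      ∈-filter⁺ holds? (∈-allFin _) (proj₂ (All.lookup sats v∈)))

  conj-sem : ∀ φ χ ρ → Sat G (Whole G) ρ (conj φ χ) ⇔ (Sat G (Whole G) ρ φ × Sat G (Whole G) ρ χ)
  conj-sem φ χ ρ = de-morgan (sat? φ ρ) (sat? χ ρ)

  ex≥-map : ∀ {D D' : Vertex G → Set} {ρ ρ' p q x} {φ φ' : Formula m} →
    (∀ {v} → D v × Sat G D (update ρ x v) φ → D' v × Sat G D' (update ρ' x v) φ') →
    Sat G D ρ (ex≥ p q x φ) → Sat G D' ρ' (ex≥ p q x φ')
  ex≥-map f (vs , u , p≤ , sats) = vs , u , p≤ , All.map f sats

  ex≥-witness : ∀ {D ρ p q x φ} → Sat G D ρ (ex≥ p q x φ) →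
    Σ (Vertex G) λ v → D v × Sat G D (update ρ x v) φ
  ex≥-witness {q = q} ([] , _ , p≤ , _) with ≤-trans q p≤
  ... | ()
  ex≥-witness (v ∷ _ , _ , _ , w ∷ _) = v , w

  ex₁-intro : ∀ {D ρ x φ} v → D v → Sat G D (update ρ x v) φ → Sat G D ρ (ex≥ 1 (s≤s z≤n) x φ)
  ex₁-intro v Dv sat = [ v ] , [] ∷ [] , s≤s z≤n , (Dv , sat) ∷ []

  coincidence : ∀ {D} φ {ρ ρ'} → (∀ {z} → z ∈ fv φ → ρ z ≡ ρ' z) → Sat G D ρ φ → Sat G D ρ' φ
  coincidence (eq x y)    agree s = trans (sym (agree (here refl))) (trans s (agree (there (here refl))))
  coincidence (edge x y)  agree s = subst₂ (λ u v → E G u v ≡ true) (agree (here refl)) (agree (there (here refl))) s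
  coincidence (col c x y) agree s = subst₂ (λ u v → R G c u v ≡ true) (agree (here refl)) (agree (there (here refl))) s
  coincidence (neg φ)     agree ¬s s' = ¬s (coincidence φ (λ z∈ → sym (agree z∈)) s')
  coincidence (or φ χ)    agree (inj₁ s) = inj₁ (coincidence φ (λ z∈ → agree (∈-++⁺ˡ z∈)) s)
  coincidence (or φ χ)    agree (inj₂ s) = inj₂ (coincidence χ (λ z∈ → agree (∈-++⁺ʳ (fv φ) z∈)) s)
  coincidence (ex≥ p q x φ) {ρ} {ρ'} agree =
    ex≥-map {q = q} {φ = φ} {φ' = φ} λ {v} (Dv , s) → Dv , coincidence φ (agree-updated v) s
    where
    agree-updated : ∀ v {z} → z ∈ fv φ → update ρ x v z ≡ update ρ' x v z
    agree-updated v {z} z∈ with z ≟ x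
    ... | yes refl = trans (update-same ρ z v) (sym (update-same ρ' z v))
    ... | no  z≢x  = trans (update-other ρ x v z≢x)
                       (trans (agree (fv-ex⁺ {p = p} {q} {φ = φ} z∈ z≢x)) (sym (update-other ρ' x v z≢x)))

  update-irrelevant : ∀ {D} φ {ρ x v} → x ∉ fv φ → Sat G D ρ φ ⇔ Sat G D (update ρ x v) φ
  update-irrelevant φ {ρ} {x} {v} x∉ = mk⇔ (coincidence φ λ z∈ → sym (unchanged z∈))
                                           (coincidence φ unchanged)
    where
    unchanged : ∀ {z} → z ∈ fv φ → update ρ x v z ≡ ρ z
    unchanged z∈ = update-other ρ x v λ { refl → x∉ z∈ }

-- The distance formula

-- Within j a b c: "b is at distance ≤ j from a".  The auxiliary variable c
-- and b swap roles at each level, so three variables suffice.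
Within : ∀ {m} → ℕ → Var → Var → Var → Formula m
Within zero    a b c = eq a b
Within (suc j) a b c = or (Within j a b c) (ex≥ 1 (s≤s z≤n) c (conj (Within j a c b) (edge c b)))

module _ {m} (G : Graph m) where
  open Walks G
  open Semantics G

  within-sem : ∀ j {a b c} → a ≢ b → a ≢ c → b ≢ c → ∀ ρ →
    Sat G (Whole G) ρ (Within j a b c) ⇔ WalkLe j (ρ a) (ρ b)
  within-sem zero _ _ _ ρ = ⇔-id _
  within-sem (suc j) {a} {b} {c} a≢b a≢c b≢c ρ =
    within-sem j a≢b a≢c b≢c ρ ⊎-⇔ mk⇔ to-step from-step
    where
    stepφ : Formula m
    stepφ = conj (Within j a c b) (edge c b)
    c≢b : c ≢ b
    c≢b c≡b = b≢c (sym c≡b)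
    body : ∀ v → Sat G (Whole G) (update ρ c v) stepφ ⇔
                 (WalkLe j (ρ a) v × E G v (ρ b) ≡ true)
    body v = relabel (update-other ρ c v a≢c) (update-same ρ c v) (update-other ρ c v b≢c)
             ⇔-∘ ((within-sem j a≢c a≢b c≢b (update ρ c v) ×-⇔ ⇔-id _)
             ⇔-∘ conj-sem (Within j a c b) (edge c b) (update ρ c v))
      where
      relabel : ∀ {a' c' b'} → a' ≡ ρ a → c' ≡ v → b' ≡ ρ b →
                (WalkLe j a' c' × E G c' b' ≡ true) ⇔ (WalkLe j (ρ a) v × E G v (ρ b) ≡ true)
      relabel refl refl refl = ⇔-id _
    to-step : Sat G (Whole G) ρ (ex≥ 1 (s≤s z≤n) c stepφ) →
              Σ (Vertex G) λ v → WalkLe j (ρ a) v × E G v (ρ b) ≡ true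
    to-step s with ex≥-witness {q = s≤s z≤n} {φ = stepφ} s
    ... | v , _ , sv = v , to (body v) sv
    from-step : (Σ (Vertex G) λ v → WalkLe j (ρ a) v × E G v (ρ b) ≡ true) →
                Sat G (Whole G) ρ (ex≥ 1 (s≤s z≤n) c stepφ)
    from-step (v , walk) = ex₁-intro {φ = stepφ} v tt (from (body v) walk)

-- Width bookkeeping

Vars : ∀ {m} → Formula m → List Var
Vars (eq x y)      = x ∷ y ∷ []
Vars (edge x y)    = x ∷ y ∷ []
Vars (col _ x y)   = x ∷ y ∷ []
Vars (neg φ)       = Vars φ
Vars (or φ χ)      = Vars φ ++ Vars χ
Vars (ex≥ _ _ x φ) = x ∷ Vars φ

fv⊆Vars : ∀ {m} (φ : Formula m) → fv φ ⊆ Vars φ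
fv⊆Vars (eq x y)      z∈ = z∈
fv⊆Vars (edge x y)    z∈ = z∈
fv⊆Vars (col _ x y)   z∈ = z∈
fv⊆Vars (neg φ)       z∈ = fv⊆Vars φ z∈
fv⊆Vars (or φ χ)      z∈ with ∈-++⁻ (fv φ) z∈
... | inj₁ z∈φ = ∈-++⁺ˡ (fv⊆Vars φ z∈φ)
... | inj₂ z∈χ = ∈-++⁺ʳ (Vars φ) (fv⊆Vars χ z∈χ)
fv⊆Vars (ex≥ p q x φ) z∈ = there (fv⊆Vars φ (proj₁ (fv-ex⁻ {p = p} {q} {φ = φ} z∈)))

width-vars : ∀ {m} (φ : Formula m) {Ws} → Vars φ ⊆ Ws → Width (length Ws) φ
width-vars φ@(eq _ _)       V⊆ = nvars-≤ (λ z∈ → V⊆ (fv⊆Vars φ z∈))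
width-vars φ@(edge _ _)     V⊆ = nvars-≤ (λ z∈ → V⊆ (fv⊆Vars φ z∈))
width-vars φ@(col _ _ _)    V⊆ = nvars-≤ (λ z∈ → V⊆ (fv⊆Vars φ z∈))
width-vars φ@(neg ψ)        V⊆ = nvars-≤ (λ z∈ → V⊆ (fv⊆Vars φ z∈)) , width-vars ψ V⊆
width-vars φ@(or ψ χ)       V⊆ = nvars-≤ (λ z∈ → V⊆ (fv⊆Vars φ z∈)) ,
                                 width-vars ψ (λ z∈ → V⊆ (∈-++⁺ˡ z∈)) ,
                                 width-vars χ (λ z∈ → V⊆ (∈-++⁺ʳ (Vars ψ) z∈))
width-vars φ@(ex≥ _ _ _ ψ)  V⊆ = nvars-≤ (λ z∈ → V⊆ (fv⊆Vars φ z∈)) , width-vars ψ (λ z∈ → V⊆ (there z∈))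

width-mono : ∀ {m} (φ : Formula m) {ℓ ℓ'} → ℓ ≤ ℓ' → Width ℓ φ → Width ℓ' φ
width-mono (eq _ _)       le w        = ≤-trans w le
width-mono (edge _ _)     le w        = ≤-trans w le
width-mono (col _ _ _)    le w        = ≤-trans w le
width-mono (neg ψ)        le (w , wψ) = ≤-trans w le , width-mono ψ le wψ
width-mono (or ψ χ)       le (w , wψ , wχ) = ≤-trans w le , width-mono ψ le wψ , width-mono χ le wχ
width-mono (ex≥ _ _ _ ψ)  le (w , wψ) = ≤-trans w le , width-mono ψ le wψ

width-top : ∀ {m} (φ : Formula m) {ℓ} → Width ℓ φ → nfv φ ≤ ℓ
width-top (eq _ _)      w       = w
width-top (edge _ _)    w       = w
width-top (col _ _ _)   w       = w
width-top (neg _)       (w , _) = w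
width-top (or _ _)      (w , _) = w
width-top (ex≥ _ _ _ _) (w , _) = w

width-conj : ∀ {m ℓ} (φ χ : Formula m) → nvars (fv φ ++ fv χ) ≤ ℓ → Width ℓ φ → Width ℓ χ → Width ℓ (conj φ χ)
width-conj φ χ bound wφ wχ = bound , bound , (width-top φ wφ , wφ) , (width-top χ wχ , wχ)

width-ex : ∀ {m ℓ} p q x (φ : Formula m) → Width ℓ φ → Width ℓ (ex≥ p q x φ)
width-ex p q x φ wφ = ≤-trans (nvars-mono (λ z∈ → proj₁ (fv-ex⁻ {p = p} {q} {φ = φ} z∈))) (width-top φ wφ) , wφ

within-vars : ∀ {m} j {a b c Ws} → a ∈ Ws → b ∈ Ws → c ∈ Ws → Vars (Within {m} j a b c) ⊆ Ws
within-vars zero    a∈ b∈ c∈ (here refl)         = a∈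
within-vars zero    a∈ b∈ c∈ (there (here refl)) = b∈
within-vars zero    a∈ b∈ c∈ (there (there ()))
within-vars (suc j) a∈ b∈ c∈ =
  ++-⊆ (within-vars j a∈ b∈ c∈) (∈-∷⁺ʳ c∈ (++-⊆ (within-vars j a∈ c∈ b∈) (∈-∷⁺ʳ c∈ (∈-∷⁺ʳ b∈ λ ()))))

within-fv : ∀ {m} j {a b c} → fv (Within {m} j a b c) ⊆ a ∷ b ∷ []
within-fv zero    z∈ = z∈
within-fv {m} (suc j) {a} {b} {c} = ++-⊆ (within-fv j) step-fv
  where
  -- the auxiliary variable c is bound
  step-fv : fv {m} (ex≥ 1 (s≤s z≤n) c (conj (Within j a c b) (edge c b))) ⊆ a ∷ b ∷ []
  step-fv z∈ with fv-ex⁻ {p = 1} {s≤s z≤n} {φ = conj (Within {m} j a c b) (edge c b)} z∈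
  ... | z∈body , z≢c with ∈-++⁻ (fv (Within {m} j a c b)) z∈body
  ...   | inj₂ (here refl)    = ⊥-elim (z≢c refl)
  ...   | inj₂ (there z∈[b])  = there z∈[b]
  ...   | inj₁ z∈within with within-fv j z∈within
  ...     | here refl         = here refl
  ...     | there (here refl) = ⊥-elim (z≢c refl)

-- Relativisation to the component, semantically

module Relativisation (m n : ℕ) where

  -- "x is reachable from r"; the auxiliary variable differs from r and x.
  Reaches : Var → Var → Formula m
  Reaches r x = Within n r x (suc (r + x))

  reaches-fv : ∀ r x → fv (Reaches r x) ⊆ r ∷ x ∷ []
  reaches-fv r x = within-fv n

  reaches-width : ∀ r x → Width 3 (Reaches r x)
  reaches-width r x = width-vars (Reaches r x) {r ∷ x ∷ suc (r + x) ∷ []}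
                        (within-vars n (here refl) (there (here refl)) (there (there (here refl))))

  module _ (G : Graph m) (ord : order G ≤ n) where
    open Walks G

    reaches-sem : ∀ {r x} → r ≢ x → ∀ ρ → Sat G (Whole G) ρ (Reaches r x) ⇔ Reach G (ρ r) (ρ x)
    reaches-sem {r} {x} r≢x ρ =
      mk⇔ (walk→reach n) (reach→walk ord) ⇔-∘ within-sem G n r≢x r≢aux x≢aux ρ
      where
      r≢aux : r ≢ suc (r + x)
      r≢aux = <⇒≢ (s≤s (m≤m+n r x))
      x≢aux : x ≢ suc (r + x)
      x≢aux = <⇒≢ (s≤s (m≤n+m x r))

    guard-sem : ∀ {a r x ρ} → r ≢ x → Reach G a (ρ r) → ∀ v →
      Sat G (Whole G) (update ρ x v) (Reaches r x) ⇔ Reach G a v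
    guard-sem {a} {r} {x} {ρ} r≢x a↝r v =
      reach-from-component a↝r ⇔-∘
      subst₂ (λ s t → Sat G (Whole G) (update ρ x v) (Reaches r x) ⇔ Reach G s t)
        (update-other ρ x v r≢x) (update-same ρ x v) (reaches-sem r≢x (update ρ x v))

  Relativises : Formula m → Formula m → Set
  Relativises ψ̂ ψ = ∀ (G : Graph m) → order G ≤ n → (a : Vertex G) (ρ : Var → Vertex G) →
    (∀ y → Reach G a (ρ y)) → Sat G (Whole G) ρ ψ̂ ⇔ Sat G (Component G a) ρ ψ

  neg-rel : ∀ {φ̂ φ} → Relativises φ̂ φ → Relativises (neg φ̂) (neg φ)
  neg-rel rel G ord a ρ inC = mk⇔ (λ ¬s s → ¬s (from r s)) (λ ¬s s → ¬s (to r s))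
    where r = rel G ord a ρ inC

  or-rel : ∀ {φ̂ φ χ̂ χ} → Relativises φ̂ φ → Relativises χ̂ χ → Relativises (or φ̂ χ̂) (or φ χ)
  or-rel relφ relχ G ord a ρ inC = relφ G ord a ρ inC ⊎-⇔ relχ G ord a ρ inC

  guarded-sem : ∀ {s x p q φ̂ φ} → s ≢ x → Relativises φ̂ φ →
    Relativises (ex≥ p q x (conj (Reaches s x) φ̂)) (ex≥ p q x φ)
  guarded-sem {s} {x} {p} {q} {φ̂} {φ} s≢x rel G ord a ρ inC =
    mk⇔ (ex≥-map {q = q} {φ = body} {φ' = φ} restrict) (ex≥-map {q = q} {φ = φ} {φ' = body} extend)
    where
    open Semantics G
    body = conj (Reaches s x) φ̂
    guard : ∀ v → Sat G (Whole G) (update ρ x v) (Reaches s x) ⇔ Reach G a v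
    guard = guard-sem G ord s≢x (inC s)
    relφ : ∀ {v} → Reach G a v → Sat G (Whole G) (update ρ x v) φ̂ ⇔ Sat G (Component G a) (update ρ x v) φ
    relφ a↝v = rel G ord a (update ρ x _) (update-preserves (Reach G a) x inC a↝v)
    restrict : ∀ {v} → ⊤ × Sat G (Whole G) (update ρ x v) body → Reach G a v × Sat G (Component G a) (update ρ x v) φ
    restrict {v} (_ , sat) with to (conj-sem (Reaches s x) φ̂ (update ρ x v)) sat
    ... | reached , satφ̂ with to (guard v) reached
    ...   | a↝v = a↝v , to (relφ a↝v) satφ̂
    extend : ∀ {v} → Reach G a v × Sat G (Component G a) (update ρ x v) φ → ⊤ × Sat G (Whole G) (update ρ x v) body
    extend {v} (a↝v , satφ) = tt , from (conj-sem (Reaches s x) φ̂ (update ρ x v)) (from (guard v) a↝v , from (relφ a↝v) satφ)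

  -- A vacuous quantification ∃^{≥p} x φ says φ and "the component has ≥ p vertices".
  vacuous-sem : ∀ {s x p q φ̂ φ} → s ≢ x → x ∉ fv φ → Relativises φ̂ φ →
    Relativises (conj φ̂ (ex≥ p q x (Reaches s x))) (ex≥ p q x φ)
  vacuous-sem {s} {x} {p} {q} {φ̂} {φ} s≢x x∉ rel G ord a ρ inC = mk⇔ restrict extend
    where
    open Semantics G
    count = ex≥ p q x (Reaches s x)
    -- once φ holds, the body holds exactly at the vertices of the component
    body : Sat G (Component G a) ρ φ → ∀ v →
      (⊤ × Sat G (Whole G) (update ρ x v) (Reaches s x)) ⇔ (Reach G a v × Sat G (Component G a) (update ρ x v) φ)
    body satφ v = mk⇔ (λ (_ , g) → to guard g , to (update-irrelevant φ x∉) satφ) (λ (a↝v , _) → tt , from guard a↝v)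
      where guard = guard-sem G ord s≢x (inC s) v
    restrict : Sat G (Whole G) ρ (conj φ̂ count) → Sat G (Component G a) ρ (ex≥ p q x φ)
    restrict sat with to (conj-sem φ̂ count ρ) sat
    ... | satφ̂ , many = ex≥-map {q = q} {φ = Reaches s x} {φ' = φ} (λ {v} → to (body satφ v)) many
      where satφ = to (rel G ord a ρ inC) satφ̂
    extend : Sat G (Component G a) ρ (ex≥ p q x φ) → Sat G (Whole G) ρ (conj φ̂ count)
    extend many = from (conj-sem φ̂ count ρ)
      (from (rel G ord a ρ inC) satφ , ex≥-map {q = q} {φ = φ} {φ' = Reaches s x} (λ {v} → from (body satφ v)) many)
      where satφ = from (update-irrelevant φ x∉) (proj₂ (proj₂ (ex≥-witness {q = q} {φ = φ} many)))

  renamed-sem : ∀ {y x ψ̂ ψ} → y ≢ x → y ∉ fv ψ → Relativises ψ̂ ψ →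
    Relativises (ex≥ 1 (s≤s z≤n) y (conj (eq y x) ψ̂)) ψ
  renamed-sem {y} {x} {ψ̂} {ψ} y≢x y∉ rel G ord a ρ inC = mk⇔ restrict extend
    where
    open Semantics G
    x≢y : x ≢ y
    x≢y x≡y = y≢x (sym x≡y)
    restrict : Sat G (Whole G) ρ (ex≥ 1 (s≤s z≤n) y (conj (eq y x) ψ̂)) → Sat G (Component G a) ρ ψ
    restrict sat with ex≥-witness {q = s≤s z≤n} {φ = conj (eq y x) ψ̂} sat
    ... | v , _ , satv with to (conj-sem (eq y x) ψ̂ (update ρ y v)) satv
    ...   | y≡x , satψ̂ = from (update-irrelevant ψ y∉)
                           (to (rel G ord a (update ρ y v) (update-preserves (Reach G a) y inC a↝v)) satψ̂)
      where
      v≡ρx : v ≡ ρ x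
      v≡ρx = trans (sym (update-same ρ y v)) (trans y≡x (update-other ρ y v x≢y))
      a↝v : Reach G a v
      a↝v = subst (Reach G a) (sym v≡ρx) (inC x)
    extend : Sat G (Component G a) ρ ψ → Sat G (Whole G) ρ (ex≥ 1 (s≤s z≤n) y (conj (eq y x) ψ̂))
    extend sat = ex₁-intro {φ = conj (eq y x) ψ̂} (ρ x) tt (from (conj-sem (eq y x) ψ̂ ρ[y↦ρx])
      (y↦ρx , from (rel G ord a ρ[y↦ρx] (update-preserves (Reach G a) y inC (inC x))) (to (update-irrelevant ψ y∉) sat)))
      where
      ρ[y↦ρx] = update ρ y (ρ x)
      y↦ρx : ρ[y↦ρx] y ≡ ρ[y↦ρx] x
      y↦ρx = trans (update-same ρ y (ρ x)) (sym (update-other ρ y (ρ x) x≢y))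

-- The width-preserving translation

free-or-closed : ∀ {m} (ψ : Formula m) → Σ Var (_∈ fv ψ) ⊎ (∀ {z} → z ∉ fv ψ)
free-or-closed ψ with fv ψ
... | []    = inj₂ λ ()
... | s ∷ _ = inj₁ (s , here refl)

module Translate (m n ℓ : ℕ) (3≤ℓ : 3 ≤ ℓ) where
  open Relativisation m n

  record Translation (ψ : Formula m) (r : Var) : Set where
    field
      formula     : Formula m
      width       : Width ℓ formula
      free        : fv formula ⊆ r ∷ fv ψ
      relativises : Relativises formula ψ
  open Translation

  fits : ∀ {xs ys} → xs ⊆ ys → length ys ≤ ℓ → nvars xs ≤ ℓ
  fits xs⊆ys le = ≤-trans (nvars-≤ xs⊆ys) le

  2≤ℓ : 2 ≤ ℓ
  2≤ℓ = ≤-trans (s≤s (s≤s z≤n)) 3≤ℓ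

  reaches-widthℓ : ∀ s x → Width ℓ (Reaches s x)
  reaches-widthℓ s x = width-mono (Reaches s x) 3≤ℓ (reaches-width s x)

  keep : ∀ {p q x} {φ : Formula m} {s z} → z ∈ s ∷ fv φ → z ≢ x → z ∈ s ∷ fv (ex≥ p q x φ)
  keep (here refl) _   = here refl
  keep {p} {q} {φ = φ} (there z∈) z≢x = there (fv-ex⁺ {p = p} {q} {φ = φ} z∈ z≢x)

  -- Atomic formulae do not quantify, so they are their own translation.
  atomic : ∀ {ψ r} → Width ℓ ψ → Relativises ψ ψ → Translation ψ r
  atomic {ψ} w rel = record { formula = ψ ; width = w ; free = there ; relativises = rel }

  negation : ∀ {φ r} → Translation φ r → Translation (neg φ) r
  negation t = record
    { formula     = neg (formula t)
    ; width       = width-top (formula t) (width t) , width t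
    ; free        = free t
    ; relativises = neg-rel (relativises t) }

  disjunction : ∀ {φ χ r} → nvars (r ∷ fv φ ++ fv χ) ≤ ℓ → Translation φ r → Translation χ r → Translation (or φ χ) r
  disjunction {φ} {χ} {r} bound tφ tχ = record
    { formula     = or (formula tφ) (formula tχ)
    ; width       = ≤-trans (nvars-mono free⊆) bound , width tφ , width tχ
    ; free        = free⊆
    ; relativises = or-rel (relativises tφ) (relativises tχ) }
    where
    free⊆ : fv (formula tφ) ++ fv (formula tχ) ⊆ r ∷ fv φ ++ fv χ
    free⊆ = ++-⊆ (λ z∈ → ∷⁺ʳ r (xs⊆xs++ys (fv φ) (fv χ)) (free tφ z∈))
                 (λ z∈ → ∷⁺ʳ r (xs⊆ys++xs (fv χ) (fv φ)) (free tχ z∈))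

  guarded : ∀ {p q x φ s} → s ≢ x → nvars (s ∷ x ∷ fv φ) ≤ ℓ → Translation φ s → Translation (ex≥ p q x φ) s
  guarded {p} {q} {x} {φ} {s} s≢x bound t = record
    { formula     = ex≥ p q x body
    ; width       = width-ex p q x body
                      (width-conj (Reaches s x) (formula t) (≤-trans (nvars-mono body⊆) bound)
                         (reaches-widthℓ s x) (width t))
    ; free        = free⊆
    ; relativises = guarded-sem {p = p} {q} {formula t} {φ} s≢x (relativises t) }
    where
    body = conj (Reaches s x) (formula t)
    body⊆ : fv body ⊆ s ∷ x ∷ fv φ
    body⊆ = ++-⊆ (λ z∈ → ∷⁺ʳ s (∷⁺ʳ x λ ()) (reaches-fv s x z∈))
                 (λ z∈ → ∷⁺ʳ s (xs⊆x∷xs (fv φ) x) (free t z∈))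
    free⊆ : fv (ex≥ p q x body) ⊆ s ∷ fv (ex≥ p q x φ)
    free⊆ z∈ with fv-ex⁻ {p = p} {q} {φ = body} z∈
    ... | z∈body , z≢x with body⊆ z∈body
    ...   | here refl          = here refl
    ...   | there (here refl)  = ⊥-elim (z≢x refl)
    ...   | there (there z∈φ)  = keep {p = p} {q} {φ = φ} (there z∈φ) z≢x

  vacuous : ∀ {p q x φ s} → s ≢ x → x ∉ fv φ → nvars (s ∷ fv φ) ≤ ℓ → Translation φ s → Translation (ex≥ p q x φ) s
  vacuous {p} {q} {x} {φ} {s} s≢x x∉ bound t = record
    { formula     = conj (formula t) count
    ; width       = width-conj (formula t) count (≤-trans (nvars-mono conj⊆) bound)
                      (width t) (width-ex p q x (Reaches s x) (reaches-widthℓ s x))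
    ; free        = λ z∈ → keep {p = p} {q} {φ = φ} (conj⊆ z∈) (x-absent (conj⊆ z∈))
    ; relativises = vacuous-sem {p = p} {q} {formula t} {φ} s≢x x∉ (relativises t) }
    where
    count = ex≥ p q x (Reaches s x)
    count⊆ : fv count ⊆ s ∷ fv φ
    count⊆ z∈ with fv-ex⁻ {p = p} {q} {φ = Reaches s x} z∈
    ... | z∈reach , z≢x with reaches-fv s x z∈reach
    ...   | here refl         = here refl
    ...   | there (here refl) = ⊥-elim (z≢x refl)
    conj⊆ : fv (formula t) ++ fv count ⊆ s ∷ fv φ
    conj⊆ = ++-⊆ (free t) count⊆
    x-absent : ∀ {z} → z ∈ s ∷ fv φ → z ≢ x
    x-absent (here refl) = s≢x
    x-absent (there z∈φ) refl = x∉ z∈φ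

  renamed : ∀ {ψ y x} → y ≢ x → y ∉ fv ψ → nvars (y ∷ x ∷ fv ψ) ≤ ℓ → Translation ψ y → Translation ψ x
  renamed {ψ} {y} {x} y≢x y∉ bound t = record
    { formula     = ex≥ 1 (s≤s z≤n) y body
    ; width       = width-ex 1 (s≤s z≤n) y body
                      (width-conj (eq y x) (formula t) (≤-trans (nvars-mono body⊆) bound)
                         (fits {xs = y ∷ x ∷ []} ⊆-refl 2≤ℓ) (width t))
    ; free        = free⊆
    ; relativises = renamed-sem y≢x y∉ (relativises t) }
    where
    body = conj (eq y x) (formula t)
    body⊆ : fv body ⊆ y ∷ x ∷ fv ψ
    body⊆ = ++-⊆ (∷⁺ʳ y (∷⁺ʳ x λ ())) (λ z∈ → ∷⁺ʳ y (xs⊆x∷xs (fv ψ) x) (free t z∈))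
    free⊆ : fv (ex≥ 1 (s≤s z≤n) y body) ⊆ x ∷ fv ψ
    free⊆ z∈ with fv-ex⁻ {p = 1} {s≤s z≤n} {φ = body} z∈
    ... | z∈body , z≢y with body⊆ z∈body
    ...   | here refl  = ⊥-elim (z≢y refl)
    ...   | there z∈xψ = z∈xψ

  reanchor : ∀ {ψ s r} → s ∈ fv ψ → Translation ψ s → Translation ψ r
  reanchor s∈ t = record
    { formula = formula t ; width = width t ; relativises = relativises t
    ; free    = λ z∈ → there (∈-∷⁺ʳ s∈ ⊆-refl (free t z∈)) }

  Translatable : Formula m → Set
  Translatable φ = ∀ s → nvars (s ∷ fv φ) ≤ ℓ → Translation φ s

  -- ∃x φ with a free variable s: anchor at s ∈ fv φ; then all variables of
  -- the translation already occur in φ.  A vacuous x is split off.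
  anchored-at-free : ∀ {p q x φ s} → s ∈ fv (ex≥ p q x φ) → Width ℓ φ → Translatable φ → Translation (ex≥ p q x φ) s
  anchored-at-free {p} {q} {x} {φ} {s} s∈ wφ translateφ = by-occurrence (any? (x ≟_) (fv φ))
    where
    s∈φ : s ∈ fv φ
    s∈φ = proj₁ (fv-ex⁻ {p = p} {q} {φ = φ} s∈)
    s≢x : s ≢ x
    s≢x = proj₂ (fv-ex⁻ {p = p} {q} {φ = φ} s∈)
    within-φ : ∀ {xs} → xs ⊆ fv φ → nvars xs ≤ ℓ
    within-φ xs⊆ = ≤-trans (nvars-mono xs⊆) (width-top φ wφ)
    tφ : Translation φ s
    tφ = translateφ s (within-φ (∈-∷⁺ʳ s∈φ ⊆-refl))
    by-occurrence : Dec (x ∈ fv φ) → Translation (ex≥ p q x φ) s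
    by-occurrence (yes x∈φ) = guarded s≢x (within-φ (∈-∷⁺ʳ s∈φ (∈-∷⁺ʳ x∈φ ⊆-refl))) tφ
    by-occurrence (no  x∉φ) = vacuous s≢x x∉φ (within-φ (∈-∷⁺ʳ s∈φ ⊆-refl)) tφ

  -- A sentence ∃x φ: fv φ ⊆ {x}, so any anchor r fits; if r is x itself,
  -- anchor at x + 1 instead and rename.
  anchored-closed : ∀ {p q x φ} → (∀ {z} → z ∉ fv (ex≥ p q x φ)) → Translatable φ → ∀ r → Translation (ex≥ p q x φ) r
  anchored-closed {p} {q} {x} {φ} closed translateφ r = by-clash (r ≟ x)
    where
    φ⊆x : fv φ ⊆ x ∷ []
    φ⊆x {z} z∈ with z ≟ x
    ... | yes refl = here refl
    ... | no  z≢x  = ⊥-elim (closed (fv-ex⁺ {p = p} {q} {φ = φ} z∈ z≢x))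
    guarded-at : ∀ s → s ≢ x → Translation (ex≥ p q x φ) s
    guarded-at s s≢x =
      guarded s≢x (fits s∷x∷φ⊆ 2≤ℓ) (translateφ s (fits (λ z∈ → s∷x∷φ⊆ (∷⁺ʳ s (xs⊆x∷xs (fv φ) x) z∈)) 2≤ℓ))
      where
      s∷x∷φ⊆ : s ∷ x ∷ fv φ ⊆ s ∷ x ∷ []
      s∷x∷φ⊆ = ∷⁺ʳ s (∈-∷⁺ʳ (here refl) φ⊆x)
    by-clash : Dec (r ≡ x) → Translation (ex≥ p q x φ) r
    by-clash (no r≢x)  = guarded-at r r≢x
    by-clash (yes refl) = renamed y≢x closed (fits (∷⁺ʳ y (∷⁺ʳ x closed⊆)) 2≤ℓ) (guarded-at y y≢x)
      where
      closed⊆ : fv (ex≥ p q x φ) ⊆ []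
      closed⊆ z∈ = ⊥-elim (closed z∈)
      y = suc x
      y≢x : y ≢ x
      y≢x y≡x = <⇒≢ (n<1+n x) (sym y≡x)

  quantified : ∀ {p q x φ} r → Width ℓ φ → Translatable φ → Translation (ex≥ p q x φ) r
  quantified {p} {q} {x} {φ} r wφ translateφ with free-or-closed (ex≥ p q x φ)
  ... | inj₁ (s , s∈) = reanchor s∈ (anchored-at-free s∈ wφ translateφ)
  ... | inj₂ closed   = anchored-closed closed translateφ r

  translate : ∀ ψ → Width ℓ ψ → Translatable ψ
  translate (eq _ _)    w _ _ = atomic w λ _ _ _ _ _ → ⇔-id _
  translate (edge _ _)  w _ _ = atomic w λ _ _ _ _ _ → ⇔-id _
  translate (col _ _ _) w _ _ = atomic w λ _ _ _ _ _ → ⇔-id _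
  translate (neg φ) (_ , wφ) r bound = negation (translate φ wφ r bound)
  translate (or φ χ) (_ , wφ , wχ) r bound =
    disjunction bound (translate φ wφ r (≤-trans (nvars-mono (∷⁺ʳ r (xs⊆xs++ys (fv φ) (fv χ)))) bound))
                      (translate χ wχ r (≤-trans (nvars-mono (∷⁺ʳ r (xs⊆ys++xs (fv χ) (fv φ)))) bound))
  translate (ex≥ p q x φ) (_ , wφ) r _ = quantified r wφ (translate φ wφ)

lemma3p5 : (m n ℓ k : ℕ) → 1 ≤ n → 3 ≤ ℓ → 1 ≤ k → k ≤ ℓ →
    (ψ : Formula m) → Width ℓ ψ → FreeAmong k ψ →
    Σ (Formula m) λ ψ̂ → Width ℓ ψ̂ × FreeAmong k ψ̂ ×
      ((G : Graph m) → order G ≤ n →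
       (a : Vertex G) (u : Fin k → Vertex G) → (∀ i → Component G a (u i)) →
       (Sat G (Whole G) (assign a u) ψ̂ ⇔ Sat G (Component G a) (assign a u) ψ))
lemma3p5 m n ℓ k _ 3≤ℓ 1≤k k≤ℓ ψ w among =
  formula t , width t , All.tabulate (λ z∈ → All.lookup anchor∷among (free t z∈)) ,
  λ G ord a u inC → relativises t G ord a (assign a u) (assign-preserves (Reach G a) here inC)
  where
  open Translate m n ℓ 3≤ℓ
  open Translation
  -- the anchor is x_1, among x_1 … x_k since k ≥ 1
  anchor∷among : All (_< k) (0 ∷ fv ψ)
  anchor∷among = 1≤k ∷ among
  t : Translation ψ 0
  t = translate ψ w 0 (fits (λ z∈ → ∈-upTo⁺ (All.lookup anchor∷among z∈)) (≤-trans (≤-reflexive (length-upTo k)) k≤ℓ))
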